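{- For a positive integer $n$, let $q_{eu}^{ou}(n)$ be the number of partitions of $n$ with no part equal to $1$ in which every even part is strictly less than every odd part (partitions with all parts even or all parts odd are included). Let $q_{ou}^{eu}(n)$ be the number of partitions of $n$ with no part equal to $1$ in which every odd part is strictly less than every even part and which have at least one odd part (so partitions with all parts even are excluded, while partitions with all parts odd are included). Then for all $n>3$, \[ q_{ou}^{eu}(n) < q_{eu}^{ou}(n). \]
   Context: A partition of $n$ is a non-increasing sequence of positive integers summing to $n$; its entries are its parts. Equivalently, the generating functions are $\sum_{n\geq 0} q_{eu}^{ou}(n)q^n=\frac{1}{(1-q)(q^2;q^2)_\infty}-\frac{q}{(q;q^2)_\infty}$ and $\sum_{n\geq 0} q_{ou}^{eu}(n)q^n=\frac{1}{(q;q^2)_\infty}-\frac{1+q}{(q^2;q^2)_\infty}$, where $(a;q)_\infty=\prod_{k\geq 1}(1-aq^{k-1})$. -}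

module Defs where

open import Data.Nat using (ℕ; zero; suc; _+_; _≤_; _<_; _≟_; _≤?_; _<?_)
open import Data.Nat.Properties using ()
open import Data.List using (List; []; _∷_; length; filter; map; concatMap; upTo)
open import Data.Nat.ListAction using (sum)
open import Data.List.Relation.Unary.All using (All; all?)
open import Data.List.Relation.Unary.Any using (Any; any?)
open import Data.List.Relation.Unary.Linked using (Linked)
open import Data.List.Relation.Unary.Linked using (linked?)
open import Data.Nat.DivMod using (_%_)
open import Data.Product using (_×_; _,_)
open import Relation.Binary.PropositionalEquality using (_≡_)
open import Relation.Nullary using (¬_; Dec; yes; no)
open import Relation.Nullary.Decidable using (_×-dec_; ¬?)
open import Relation.Unary using (Decidable)
open import Data.Empty using (⊥-elim)

Even : ℕ → Set
Even m = m % 2 ≡ 0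

Odd : ℕ → Set
Odd m = m % 2 ≡ 1

IsPartition : ℕ → List ℕ → Set
IsPartition n λs = Linked (λ a b → b ≤ a) λs × All (λ p → 1 ≤ p) λs × sum λs ≡ n

EvenBelowOdd : List ℕ → Set
EvenBelowOdd λs = All (λ e → Even e → All (λ o → Odd o → e < o) λs) λs

OddBelowEven : List ℕ → Set
OddBelowEven λs = All (λ o → Odd o → All (λ e → Even e → o < e) λs) λs

NoPartOne : List ℕ → Set
NoPartOne λs = All (λ p → ¬ (p ≡ 1)) λs

Qeuou : ℕ → List ℕ → Set
Qeuou n λs = IsPartition n λs × NoPartOne λs × EvenBelowOdd λs

Qoueu : ℕ → List ℕ → Set
Qoueu n λs = IsPartition n λs × NoPartOne λs × OddBelowEven λs × Any Odd λs

-- Finite search space: all lists of length ≤ k with entries in {1,…,m}.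
-- Every partition of n lies in candidates n n.
listsUpTo : ℕ → ℕ → List (List ℕ)
listsUpTo m zero = [] ∷ []
listsUpTo m (suc k) =
  [] ∷ concatMap (λ p → map (p ∷_) (listsUpTo m k)) (map suc (upTo m))

count : {P : List ℕ → Set} → Decidable P → ℕ → ℕ
count P? n = length (filter P? (listsUpTo n n))

even? : Decidable Even
even? m = m % 2 ≟ 0

odd? : Decidable Odd
odd? m = m % 2 ≟ 1

→? : {A B : Set} → Dec A → Dec B → Dec (A → B)
→? _ (yes b) = yes (λ _ → b)
→? (no ¬a) _ = yes (λ a → ⊥-elim (¬a a))
→? (yes a) (no ¬b) = no (λ f → ¬b (f a))

isPartition? : ∀ n → Decidable (IsPartition n)
isPartition? n λs = linked? (λ a b → b ≤? a) λs ×-dec all? (λ p → 1 ≤? p) λs ×-dec (sum λs ≟ n)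

noPartOne? : Decidable NoPartOne
noPartOne? λs = all? (λ p → ¬? (p ≟ 1)) λs

evenBelowOdd? : Decidable EvenBelowOdd
evenBelowOdd? λs = all? (λ e → →? (even? e) (all? (λ o → →? (odd? o) (e <? o)) λs)) λs

oddBelowEven? : Decidable OddBelowEven
oddBelowEven? λs = all? (λ o → →? (odd? o) (all? (λ e → →? (even? e) (o <? e)) λs)) λs

Qeuou? : ∀ n → Decidable (Qeuou n)
Qeuou? n λs = isPartition? n λs ×-dec noPartOne? λs ×-dec evenBelowOdd? λs

Qoueu? : ∀ n → Decidable (Qoueu n)
Qoueu? n λs = isPartition? n λs ×-dec noPartOne? λs ×-dec oddBelowEven? λs ×-dec any? odd? λs

q-eu-ou : ℕ → ℕ
q-eu-ou n = count (Qeuou? n) n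

q-ou-eu : ℕ → ℕ
q-ou-eu n = count (Qoueu? n) n

{-# OPTIONS --safe #-}
-- A partition counted by q_ou^eu is a descending list x ∷ xs whose even parts
-- lie above its odd parts; its smallest part is odd, so every part is ≥ 3.
-- encode turns it into a partition of the same number counted by q_eu^ou.
-- All-odd partitions are fixed.  Otherwise x is even, and decrementing every part
-- of xs turns its evens into odds and its odds into evens, in the right order;
-- the |xs| units removed are given to x, which has to become odd.  If |xs| is odd,
-- x takes them all.  If |xs| is even, the largest odd part of xs keeps its unit
-- and x takes the other |xs| - 1; when that part is the only odd one this would
-- leave no even part, so instead only the last part loses a unit and x gains it.
-- The image records which case occurred (all-odd tail, odd length, all-even
-- tail, or none of these), so decode is a left inverse of encode.  For n > 3 some
-- partition counted by q_eu^ou decodes to a list with a part below 3; it is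
-- outside the image, which makes the inequality strict.
module Submission where

open import Defs
open import Data.Nat using (ℕ; zero; suc; pred; _+_; _∸_; _≤_; _<_; _≥_; z≤n; s≤s; >-nonZero)
open import Data.Nat.Properties
  using ( ≤-refl; ≤-trans; ≤∧≢⇒<; <⇒≱; <-irrefl; n≤1+n; m≤m+n; m≤n+m; pred[n]≤n; pred-mono-≤
        ; suc-pred; suc-injective; +-suc; +-assoc; +-comm; +-mono-≤; m+n∸n≡m; m+n∸m≡n
        ; +-commutativeSemigroup )
open import Algebra.Properties.CommutativeSemigroup +-commutativeSemigroup using (x∙yz≈y∙xz)
open import Data.List
  using (List; []; _∷_; map; length; filter; _++_; upTo; cartesianProductWith; concatMap)
open import Data.List.Properties using (length-map; length-++; map-∘; map-id-local; ∷-injective)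
open import Data.Nat.ListAction using (sum)
open import Data.List.Relation.Unary.All as All using (All; []; _∷_; all?)
open import Data.List.Relation.Unary.All.Properties as Allₚ using (Any¬⇒¬All; all-filter)
open import Data.List.Relation.Unary.Any as Any using (Any; here; there)
import Data.List.Relation.Unary.Any.Properties as Anyₚ
open import Data.List.Relation.Unary.Linked as Linked using (Linked; []; [-]; _∷_)
import Data.List.Relation.Unary.Linked.Properties as Linkedₚ
open import Data.List.Relation.Unary.AllPairs using ([]; _∷_)
open import Data.List.Relation.Unary.Unique.Propositional using (Unique)
open import Data.List.Relation.Unary.Unique.Propositional.Properties as Unique
  using (map⁻; cartesianProductWith⁺; upTo⁺)
open import Data.List.Relation.Binary.Subset.Propositional using (_⊆_)
open import Data.List.Membership.Propositional using (_∈_)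
open import Data.List.Membership.Propositional.Properties
  using ( ∈-∃++; ∈-map⁺; ∈-map⁻; ∈-filter⁺; ∈-filter⁻; ∈-upTo⁺
        ; ∈-cartesianProductWith⁺; ∈-cartesianProductWith⁻ )
open import Data.Product using (∃-syntax; _×_; _,_; proj₁; proj₂)
open import Function using (_∘_)
open import Relation.Nullary using (¬_; contradiction; yes; no)
open import Relation.Nullary.Decidable using (_×-dec_; decidable-stable)
open import Relation.Unary using (Decidable)
open import Relation.Binary.PropositionalEquality
  using (_≡_; _≢_; refl; sym; trans; cong; cong₂; subst; module ≡-Reasoning)

-- Parity

-- m % 2 reduces by peeling off two sucs, so these lemmas recurse on suc (suc m);
-- the number is explicit because it cannot be inferred from m % 2.
even⇒¬odd : ∀ m → Even m → ¬ Odd m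
even⇒¬odd zero          _ ()
even⇒¬odd (suc zero)    ()
even⇒¬odd (suc (suc m)) = even⇒¬odd m

¬odd⇒even : ∀ m → ¬ Odd m → Even m
¬odd⇒even zero          _   = refl
¬odd⇒even (suc zero)    ¬o  = contradiction refl ¬o
¬odd⇒even (suc (suc m)) ¬o  = ¬odd⇒even m ¬o

even⇒odd-suc : ∀ m → Even m → Odd (suc m)
even⇒odd-suc zero          _  = refl
even⇒odd-suc (suc zero)    ()
even⇒odd-suc (suc (suc m)) = even⇒odd-suc m

even-suc⇒odd : ∀ m → Even (suc m) → Odd m
even-suc⇒odd zero          ()
even-suc⇒odd (suc zero)    _  = refl
even-suc⇒odd (suc (suc m)) = even-suc⇒odd m

odd-suc⇒even : ∀ m → Odd (suc m) → Even m
odd-suc⇒even zero          _  = refl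
odd-suc⇒even (suc zero)    ()
odd-suc⇒even (suc (suc m)) = odd-suc⇒even m

even+odd⇒odd : ∀ m {n} → Even m → Odd n → Odd (m + n)
even+odd⇒odd zero          _  on = on
even+odd⇒odd (suc zero)    ()
even+odd⇒odd (suc (suc m)) = even+odd⇒odd m

odd⇒even-pred : ∀ y → Odd y → Even (pred y)
odd⇒even-pred (suc y) = odd-suc⇒even y

¬odd⇒odd-pred : ∀ y → 0 < y → ¬ Odd y → Odd (pred y)
¬odd⇒odd-pred (suc y) _ ¬oy = even-suc⇒odd y (¬odd⇒even (suc y) ¬oy)

anyEven⇒¬allOdd : ∀ {t} → Any Even t → ¬ All Odd t
anyEven⇒¬allOdd = Any¬⇒¬All ∘ Any.map λ {v} → even⇒¬odd v

anyOdd⇒¬allEven : ∀ {t} → Any Odd t → ¬ All Even t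
anyOdd⇒¬allEven = Any¬⇒¬All ∘ Any.map λ {v} ov ev → even⇒¬odd v ev ov

allEven⇒¬allOdd : ∀ {t} → 0 < length t → All Even t → ¬ All Odd t
allEven⇒¬allOdd {v ∷ _} _ (ev ∷ _) (ov ∷ _) = even⇒¬odd v ev ov

odd∧2≤⇒3≤ : ∀ m → Odd m → 2 ≤ m → 3 ≤ m
odd∧2≤⇒3≤ (suc zero)          _  (s≤s ())
odd∧2≤⇒3≤ (suc (suc zero))    ()  _
odd∧2≤⇒3≤ (suc (suc (suc m))) _   _ = s≤s (s≤s (s≤s z≤n))

-- Persistent predicates on descending lists

-- On a descending list, Persists Odd is the local form of OddBelowEven and
-- Persists Even that of EvenBelowOdd.
Persists : {A : Set} → (A → Set) → List A → Set
Persists P = Linked (λ a b → P a → P b)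

module _ {A : Set} {P : A → Set} where

  persists⇒all : ∀ {x xs} → P x → Persists P (x ∷ xs) → All P (x ∷ xs)
  persists⇒all px [-]      = px ∷ []
  persists⇒all px (p ∷ ps) = px ∷ persists⇒all (p px) ps

  all⇒persists : ∀ {xs} → All P xs → Persists P xs
  all⇒persists []                  = []
  all⇒persists (_ ∷ [])            = [-]
  all⇒persists (_ ∷ pxs@(py ∷ _)) = (λ _ → py) ∷ all⇒persists pxs

  ¬P∷persists : ∀ {x xs} → ¬ P x → Persists P xs → Persists P (x ∷ xs)
  ¬P∷persists {xs = []}    _   _  = [-]
  ¬P∷persists {xs = _ ∷ _} ¬px ps = (λ px → contradiction px ¬px) ∷ ps

  none⇒persists : ∀ {xs} → All (¬_ ∘ P) xs → Persists P xs
  none⇒persists []           = []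
  none⇒persists (¬px ∷ ¬pxs) = ¬P∷persists ¬px (none⇒persists ¬pxs)

Descending : List ℕ → Set
Descending = Linked _≥_

descending-≤-head : ∀ {x y xs} → x ≤ y → Descending (x ∷ xs) → Descending (y ∷ xs)
descending-≤-head _   [-]       = [-]
descending-≤-head x≤y (x≥z ∷ d) = ≤-trans x≥z x≤y ∷ d

descending-map-pred : ∀ {xs} → Descending xs → Descending (map pred xs)
descending-map-pred = Linkedₚ.map⁺ ∘ Linked.map pred-mono-≤

descending⇒≤head : ∀ {x xs} → Descending (x ∷ xs) → All (_≤ x) xs
descending⇒≤head [-]         = []
descending⇒≤head (x≥y ∷ y∷ys) = Linkedₚ.Linked⇒All (λ p q → ≤-trans q p) x≥y y∷ys

descending∧persists⇒< : ∀ {P : ℕ → Set} {ν e o} → Descending ν → Persists P ν →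
                        e ∈ ν → o ∈ ν → P e → ¬ P o → e < o
descending∧persists⇒< d ps (here refl) o∈ pe ¬po =
  contradiction (All.lookup (persists⇒all pe ps) o∈) ¬po
descending∧persists⇒< d ps (there e∈) (here refl) pe ¬po =
  ≤∧≢⇒< (All.lookup (descending⇒≤head d) e∈) λ { refl → ¬po pe }
descending∧persists⇒< d ps (there e∈) (there o∈) =
  descending∧persists⇒< (Linked.tail d) (Linked.tail ps) e∈ o∈

record OddsUnderEvens (l : List ℕ) : Set where
  field
    descending : Descending l
    parts≥3    : All (3 ≤_) l
    oddsLast   : Persists Odd l
    someOdd    : Any Odd l

  parts>0 : All (0 <_) l
  parts>0 = All.map (≤-trans (s≤s z≤n)) parts≥3

record EvensUnderOdds (ν : List ℕ) : Set where
  field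
    descending : Descending ν
    parts≥2    : All (2 ≤_) ν
    evensLast  : Persists Even ν

oddBelowEven-tail : ∀ {x l} → OddBelowEven (x ∷ l) → OddBelowEven l
oddBelowEven-tail (_ ∷ below) = All.map (λ b o → All.tail (b o)) below

oddBelowEven⇒persists : ∀ {l} → Descending l → OddBelowEven l → Persists Odd l
oddBelowEven⇒persists []          _ = []
oddBelowEven⇒persists [-]         _ = [-]
oddBelowEven⇒persists {x ∷ y ∷ _} (x≥y ∷ y∷ys) obe@(x-below ∷ _) =
  x→y ∷ oddBelowEven⇒persists y∷ys (oddBelowEven-tail obe)
  where
  x→y : Odd x → Odd y
  x→y ox = decidable-stable (odd? y) λ ¬oy →
    <⇒≱ (All.head (All.tail (x-below ox)) (¬odd⇒even y ¬oy)) x≥y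

parts≥2⇒parts≥3 : ∀ {l} → Descending l → Persists Odd l → Any Odd l →
                  All (2 ≤_) l → All (3 ≤_) l
parts≥2⇒parts≥3 _ ps (here oy) ≥2 =
  All.zipWith (λ (o , 2≤) → odd∧2≤⇒3≤ _ o 2≤) (persists⇒all oy ps , ≥2)
parts≥2⇒parts≥3 [-] _ (there ()) _
parts≥2⇒parts≥3 (y≥z ∷ d) (_ ∷ ps) (there any) (_ ∷ ≥2) =
  let ys≥3 = parts≥2⇒parts≥3 d ps any ≥2 in ≤-trans (All.head ys≥3) y≥z ∷ ys≥3

Qoueu⇒oddsUnderEvens : ∀ {n l} → Qoueu n l → OddsUnderEvens l
Qoueu⇒oddsUnderEvens {l = l} ((d , parts>0 , _) , no1 , obe , someOdd) = record
  { descending = d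
  ; parts≥3    = parts≥2⇒parts≥3 d oddsLast someOdd parts≥2
  ; oddsLast   = oddsLast
  ; someOdd    = someOdd
  }
  where
  oddsLast : Persists Odd l
  oddsLast = oddBelowEven⇒persists d obe

  parts≥2 : All (2 ≤_) l
  parts≥2 = All.zipWith (λ (1≤p , p≢1) → ≤∧≢⇒< 1≤p (p≢1 ∘ sym)) (parts>0 , no1)

evensUnderOdds⇒Qeuou : ∀ {n ν} → EvensUnderOdds ν → sum ν ≡ n → Qeuou n ν
evensUnderOdds⇒Qeuou shape sum≡n =
  (descending , All.map (≤-trans (n≤1+n 1)) parts≥2 , sum≡n) ,
  All.map (λ 2≤p p≡1 → <-irrefl (sym p≡1) 2≤p) parts≥2 ,
  All.tabulate λ e∈ ee → All.tabulate λ {o} o∈ oo →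
    descending∧persists⇒< descending evensLast e∈ o∈ ee (λ eo → even⇒¬odd o eo oo)
  where open EvensUnderOdds shape

-- Decrementing parts

suc∘pred : ∀ {y} → 0 < y → suc (pred y) ≡ y
suc∘pred y>0 = suc-pred _ {{>-nonZero y>0}}

map-suc∘pred : ∀ {xs} → All (0 <_) xs → map suc (map pred xs) ≡ xs
map-suc∘pred {xs} xs>0 = trans (sym (map-∘ xs)) (map-id-local (All.map suc∘pred xs>0))

map-pred-≥ : ∀ {m xs} → All (suc m ≤_) xs → All (m ≤_) (map pred xs)
map-pred-≥ []       = []
map-pred-≥ (p ∷ ps) = pred-mono-≤ p ∷ map-pred-≥ ps

length+sum-map-pred : ∀ {xs} → All (0 <_) xs → length xs + sum (map pred xs) ≡ sum xs
length+sum-map-pred []                  = refl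
length+sum-map-pred {suc y ∷ ys} (_ ∷ ps) = cong suc (begin
  length ys + (y + sum (map pred ys)) ≡⟨ x∙yz≈y∙xz (length ys) y _ ⟩
  y + (length ys + sum (map pred ys)) ≡⟨ cong (y +_) (length+sum-map-pred ps) ⟩
  y + sum ys                          ∎)
  where open ≡-Reasoning

persists-map-pred : ∀ {xs} → All (0 <_) xs → Persists Odd xs → Persists Even (map pred xs)
persists-map-pred _                   []       = []
persists-map-pred _                   [-]      = [-]
persists-map-pred {suc x ∷ y ∷ _} (_ ∷ ps) (p ∷ pps) =
  (λ ex → odd⇒even-pred y (p (even⇒odd-suc x ex))) ∷ persists-map-pred ps pps

mapLast : {A : Set} → (A → A) → List A → List A
mapLast f []           = []
mapLast f (x ∷ [])     = f x ∷ []
mapLast f (x ∷ y ∷ ys) = x ∷ mapLast f (y ∷ ys)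

length-mapLast : ∀ {A : Set} (f : A → A) xs → length (mapLast f xs) ≡ length xs
length-mapLast f []           = refl
length-mapLast f (x ∷ [])     = refl
length-mapLast f (x ∷ y ∷ ys) = cong suc (length-mapLast f (y ∷ ys))

mapLast-suc∘pred : ∀ {xs} → All (0 <_) xs → mapLast suc (mapLast pred xs) ≡ xs
mapLast-suc∘pred []                         = refl
mapLast-suc∘pred (p ∷ [])                   = cong (_∷ []) (suc∘pred p)
mapLast-suc∘pred {x ∷ y ∷ []}     (_ ∷ ps) = cong (x ∷_) (mapLast-suc∘pred ps)
mapLast-suc∘pred {x ∷ y ∷ z ∷ zs} (_ ∷ ps) = cong (x ∷_) (mapLast-suc∘pred ps)

suc-sum-mapLast-pred : ∀ {x xs} → All (0 <_) (x ∷ xs) →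
                       suc (sum (mapLast pred (x ∷ xs))) ≡ sum (x ∷ xs)
suc-sum-mapLast-pred {suc x} {[]}     _        = refl
suc-sum-mapLast-pred {x}     {y ∷ ys} (_ ∷ ps) =
  trans (sym (+-suc x _)) (cong (x +_) (suc-sum-mapLast-pred ps))

descending-mapLast-pred : ∀ {x xs} → Descending (x ∷ xs) → Descending (x ∷ mapLast pred xs)
descending-mapLast-pred [-]               = [-]
descending-mapLast-pred (x≥y ∷ [-])       = ≤-trans pred[n]≤n x≥y ∷ [-]
descending-mapLast-pred (x≥y ∷ d@(_ ∷ _)) = x≥y ∷ descending-mapLast-pred d

mapLast-pred-≥ : ∀ {m xs} → All (suc m ≤_) xs → All (m ≤_) (mapLast pred xs)
mapLast-pred-≥ []                = []
mapLast-pred-≥ (p ∷ [])          = pred-mono-≤ p ∷ []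
mapLast-pred-≥ (p ∷ ps@(_ ∷ _)) = ≤-trans (n≤1+n _) p ∷ mapLast-pred-≥ ps

allOdd⇒allEven-map-pred : ∀ {xs} → All Odd xs → All Even (map pred xs)
allOdd⇒allEven-map-pred = Allₚ.map⁺ ∘ All.map λ {y} → odd⇒even-pred y

predExceptFirstOdd : List ℕ → List ℕ
predExceptFirstOdd []       = []
predExceptFirstOdd (y ∷ ys) with odd? y
... | yes _ = y ∷ map pred ys
... | no  _ = pred y ∷ predExceptFirstOdd ys

sucExceptLastOdd : List ℕ → List ℕ
sucExceptLastOdd []       = []
sucExceptLastOdd (z ∷ zs) with odd? z ×-dec all? even? zs
... | yes _ = z ∷ map suc zs
... | no  _ = suc z ∷ sucExceptLastOdd zs

length-predExceptFirstOdd : ∀ ys → length (predExceptFirstOdd ys) ≡ length ys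
length-predExceptFirstOdd []       = refl
length-predExceptFirstOdd (y ∷ ys) with odd? y
... | yes _ = cong suc (length-map pred ys)
... | no  _ = cong suc (length-predExceptFirstOdd ys)

length+sum-predExceptFirstOdd : ∀ {ys} → Any Odd ys → All (0 <_) ys →
                                length ys + sum (predExceptFirstOdd ys) ≡ suc (sum ys)
length+sum-predExceptFirstOdd {suc y ∷ ys} any (_ ∷ ps) with odd? (suc y)
... | yes _ = cong suc (begin
  length ys + (suc y + sum (map pred ys)) ≡⟨ x∙yz≈y∙xz (length ys) (suc y) _ ⟩
  suc y + (length ys + sum (map pred ys)) ≡⟨ cong (suc y +_) (length+sum-map-pred ps) ⟩
  suc y + sum ys                          ∎)
  where open ≡-Reasoning
... | no ¬oy = cong suc (begin
  length ys + (y + sum (predExceptFirstOdd ys)) ≡⟨ x∙yz≈y∙xz (length ys) y _ ⟩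
  y + (length ys + sum (predExceptFirstOdd ys)) ≡⟨ cong (y +_) (length+sum-predExceptFirstOdd any′ ps) ⟩
  y + suc (sum ys)                              ≡⟨ +-suc y _ ⟩
  suc (y + sum ys)                              ∎)
  where
  open ≡-Reasoning

  any′ : Any Odd ys
  any′ = Any.tail ¬oy any

descending-predExceptFirstOdd : ∀ {z ys} → Descending (z ∷ ys) → Even z →
                                Descending (pred z ∷ predExceptFirstOdd ys)
descending-predExceptFirstOdd [-] _ = [-]
descending-predExceptFirstOdd {z} {y ∷ ys} (z≥y ∷ d) ez with odd? y
... | yes oy = pred-mono-≤ (≤∧≢⇒< z≥y λ y≡z → even⇒¬odd z ez (subst Odd y≡z oy))
             ∷ descending-≤-head pred[n]≤n (descending-map-pred d)
... | no ¬oy = pred-mono-≤ z≥y ∷ descending-predExceptFirstOdd d (¬odd⇒even y ¬oy)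

predExceptFirstOdd-≥ : ∀ {m ys} → All (suc m ≤_) ys → All (m ≤_) (predExceptFirstOdd ys)
predExceptFirstOdd-≥ []                  = []
predExceptFirstOdd-≥ {ys = y ∷ _} (p ∷ ps) with odd? y
... | yes _ = ≤-trans (n≤1+n _) p ∷ map-pred-≥ ps
... | no  _ = pred-mono-≤ p ∷ predExceptFirstOdd-≥ ps

persists-predExceptFirstOdd : ∀ {ys} → All (0 <_) ys → Persists Odd ys →
                              Persists Even (predExceptFirstOdd ys)
persists-predExceptFirstOdd []                  _   = []
persists-predExceptFirstOdd {y ∷ _} (p ∷ ps) per with odd? y
... | yes oy = ¬P∷persists (λ ey → even⇒¬odd y ey oy)
                 (all⇒persists (allOdd⇒allEven-map-pred (All.tail (persists⇒all oy per))))
... | no ¬oy = ¬P∷persists (λ ey → even⇒¬odd (pred y) ey (¬odd⇒odd-pred y p ¬oy))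
                 (persists-predExceptFirstOdd ps (Linked.tail per))

anyOdd-predExceptFirstOdd : ∀ {ys} → All (0 <_) ys → Any Odd ys → Any Odd (predExceptFirstOdd ys)
anyOdd-predExceptFirstOdd {y ∷ _} (p ∷ _) _ with odd? y
... | yes oy = here oy
... | no ¬oy = here (¬odd⇒odd-pred y p ¬oy)

sucExceptLastOdd∘predExceptFirstOdd : ∀ {ys} → All (0 <_) ys → Persists Odd ys → Any Odd ys →
                                      sucExceptLastOdd (predExceptFirstOdd ys) ≡ ys
sucExceptLastOdd∘predExceptFirstOdd {y ∷ ys} (p ∷ ps) per any with odd? y
... | yes oy with odd? y ×-dec all? even? (map pred ys)
...   | yes _    = cong (y ∷_) (map-suc∘pred ps)
...   | no ¬both =
  contradiction (oy , allOdd⇒allEven-map-pred (All.tail (persists⇒all oy per))) ¬both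
sucExceptLastOdd∘predExceptFirstOdd {y ∷ ys} (p ∷ ps) per any | no ¬oy
  with odd? (pred y) ×-dec all? even? (predExceptFirstOdd ys)
...   | yes (_ , allEven) =
  contradiction allEven (anyOdd⇒¬allEven (anyOdd-predExceptFirstOdd ps (Any.tail ¬oy any)))
...   | no _ = cong₂ _∷_ (suc∘pred p)
                 (sucExceptLastOdd∘predExceptFirstOdd ps (Linked.tail per) (Any.tail ¬oy any))

allEven-mapLast-pred : ∀ {ys} → All (0 <_) ys → Persists Odd ys → Any Odd ys →
                       All Odd (predExceptFirstOdd ys) → All Even (mapLast pred ys)
allEven-mapLast-pred {y ∷ []} _ _ any _ with odd? y
... | yes oy = odd⇒even-pred y oy ∷ []
... | no ¬oy = contradiction (Any.tail ¬oy any) λ ()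
allEven-mapLast-pred {y ∷ z ∷ _} (_ ∷ ps) (y→z ∷ per) any allOdd with odd? y
... | yes oy =
  contradiction (All.head (All.tail allOdd)) (even⇒¬odd (pred z) (odd⇒even-pred z (y→z oy)))
... | no ¬oy = ¬odd⇒even y ¬oy ∷ allEven-mapLast-pred ps per (Any.tail ¬oy any) (All.tail allOdd)

-- Encoding and decoding

-- When x is even, the third test holds exactly when xs has a single odd part.
encode : List ℕ → List ℕ
encode []       = []
encode (x ∷ xs) with odd? x | odd? (length xs) | all? odd? (predExceptFirstOdd xs)
... | yes _ | _     | _     = x ∷ xs
... | no  _ | yes _ | _     = (x + length xs) ∷ map pred xs
... | no  _ | no  _ | yes _ = suc x ∷ mapLast pred xs
... | no  _ | no  _ | no  _ = (length xs + pred x) ∷ predExceptFirstOdd xs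

decode : List ℕ → List ℕ
decode []      = []
decode (h ∷ t) with all? odd? t | odd? (length t) | all? even? t
... | yes _ | _     | _     = h ∷ t
... | no  _ | yes _ | _     = (h ∸ length t) ∷ map suc t
... | no  _ | no  _ | yes _ = pred h ∷ mapLast suc t
... | no  _ | no  _ | no  _ = suc (h ∸ length t) ∷ sucExceptLastOdd t

decode-allOdd : ∀ {h t} → All Odd t → decode (h ∷ t) ≡ h ∷ t
decode-allOdd {t = t} allOdd with all? odd? t
... | yes _ = refl
... | no ¬allOdd = contradiction allOdd ¬allOdd

decode-oddLength : ∀ {h t} → ¬ All Odd t → Odd (length t) →
                   decode (h ∷ t) ≡ (h ∸ length t) ∷ map suc t
decode-oddLength {t = t} ¬allOdd oddLength with all? odd? t | odd? (length t)
... | yes allOdd | _       = contradiction allOdd ¬allOdd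
... | no _       | yes _   = refl
... | no _       | no ¬odd = contradiction oddLength ¬odd

decode-allEven : ∀ {h t} → ¬ All Odd t → ¬ Odd (length t) → All Even t →
                 decode (h ∷ t) ≡ pred h ∷ mapLast suc t
decode-allEven {t = t} ¬allOdd ¬oddLength allEven with all? odd? t | odd? (length t) | all? even? t
... | yes allOdd | _         | _          = contradiction allOdd ¬allOdd
... | no _       | yes odd   | _          = contradiction odd ¬oddLength
... | no _       | no _      | yes _      = refl
... | no _       | no _      | no ¬allEven = contradiction allEven ¬allEven

decode-mixed : ∀ {h t} → ¬ All Odd t → ¬ Odd (length t) → ¬ All Even t →
               decode (h ∷ t) ≡ suc (h ∸ length t) ∷ sucExceptLastOdd t
decode-mixed {t = t} ¬allOdd ¬oddLength ¬allEven with all? odd? t | odd? (length t) | all? even? t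
... | yes allOdd | _         | _          = contradiction allOdd ¬allOdd
... | no _       | yes odd   | _          = contradiction odd ¬oddLength
... | no _       | no _      | yes allEven = contradiction allEven ¬allEven
... | no _       | no _      | no _       = refl

record Encodes (l ν : List ℕ) : Set where
  field
    shape    : EvensUnderOdds ν
    sum-≡    : sum ν ≡ sum l
    decode-≡ : decode ν ≡ l

encodes-allOdd : ∀ {x xs} → OddsUnderEvens (x ∷ xs) → Odd x → Encodes (x ∷ xs) (x ∷ xs)
encodes-allOdd {x} {xs} src ox = record
  { shape    = record
    { descending = descending
    ; parts≥2    = All.map (≤-trans (n≤1+n 2)) parts≥3
    ; evensLast  = none⇒persists (All.map (λ {y} oy ey → even⇒¬odd y ey oy) allOdd)
    }
  ; sum-≡    = refl
  ; decode-≡ = decode-allOdd (All.tail allOdd)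
  }
  where
  open OddsUnderEvens src

  allOdd : All Odd (x ∷ xs)
  allOdd = persists⇒all ox oddsLast

module EvenLargestPart {x y ys} (src : OddsUnderEvens (x ∷ y ∷ ys)) (¬ox : ¬ Odd x) where

  open OddsUnderEvens src

  private
    xs : List ℕ
    xs = y ∷ ys

    x>0 : 0 < x
    x>0 = All.head parts>0

    x≥3 : 3 ≤ x
    x≥3 = All.head parts≥3

    xs>0 : All (0 <_) xs
    xs>0 = All.tail parts>0

    xs≥3 : All (3 ≤_) xs
    xs≥3 = All.tail parts≥3

    xs-oddsLast : Persists Odd xs
    xs-oddsLast = Linked.tail oddsLast

    xs-someOdd : Any Odd xs
    xs-someOdd = Any.tail ¬ox someOdd

    ex : Even x
    ex = ¬odd⇒even x ¬ox

  encodes-oddLength : Odd (length xs) → Encodes (x ∷ xs) ((x + length xs) ∷ map pred xs)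
  encodes-oddLength oddLength = record
    { shape    = record
      { descending = descending-≤-head (≤-trans pred[n]≤n (m≤m+n x _))
                                       (descending-map-pred descending)
      ; parts≥2    = ≤-trans (n≤1+n 2) (≤-trans x≥3 (m≤m+n x _)) ∷ map-pred-≥ xs≥3
      ; evensLast  = ¬P∷persists (λ e → even⇒¬odd (x + length xs) e headOdd)
                                 (persists-map-pred xs>0 xs-oddsLast)
      }
    ; sum-≡    = trans (+-assoc x _ _) (cong (x +_) (length+sum-map-pred xs>0))
    ; decode-≡ = trans (decode-oddLength ¬allOdd (subst Odd (sym (length-map pred xs)) oddLength))
                       (cong₂ _∷_ head≡ (map-suc∘pred xs>0))
    }
    where
    headOdd : Odd (x + length xs)
    headOdd = even+odd⇒odd x ex oddLength

    ¬allOdd : ¬ All Odd (map pred xs)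
    ¬allOdd = anyEven⇒¬allOdd (Anyₚ.map⁺ (Any.map (λ {v} → odd⇒even-pred v) xs-someOdd))

    head≡ : x + length xs ∸ length (map pred xs) ≡ x
    head≡ = trans (cong (x + length xs ∸_) (length-map pred xs)) (m+n∸n≡m x (length xs))

  encodes-oneOdd : ¬ Odd (length xs) → All Odd (predExceptFirstOdd xs) →
                   Encodes (x ∷ xs) (suc x ∷ mapLast pred xs)
  encodes-oneOdd ¬oddLength allOdd = record
    { shape    = record
      { descending = descending-≤-head (n≤1+n x) (descending-mapLast-pred descending)
      ; parts≥2    = ≤-trans (n≤1+n 2) (≤-trans x≥3 (n≤1+n x)) ∷ mapLast-pred-≥ xs≥3
      ; evensLast  = ¬P∷persists (λ e → even⇒¬odd (suc x) e (even⇒odd-suc x ex))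
                                 (all⇒persists allEven)
      }
    ; sum-≡    = trans (sym (+-suc x _)) (cong (x +_) (suc-sum-mapLast-pred xs>0))
    ; decode-≡ =
        trans (decode-allEven ¬allOdd (¬oddLength ∘ subst Odd (length-mapLast pred xs)) allEven)
              (cong (x ∷_) (mapLast-suc∘pred xs>0))
    }
    where
    allEven : All Even (mapLast pred xs)
    allEven = allEven-mapLast-pred xs>0 xs-oddsLast xs-someOdd allOdd

    ¬allOdd : ¬ All Odd (mapLast pred xs)
    ¬allOdd = allEven⇒¬allOdd (subst (0 <_) (sym (length-mapLast pred xs)) (s≤s z≤n)) allEven

  encodes-manyOdds : ¬ Odd (length xs) → ¬ All Odd (predExceptFirstOdd xs) →
                     Encodes (x ∷ xs) ((length xs + pred x) ∷ predExceptFirstOdd xs)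
  encodes-manyOdds ¬oddLength ¬allOdd = record
    { shape    = record
      { descending = descending-≤-head (m≤n+m (pred x) (length xs))
                                       (descending-predExceptFirstOdd descending ex)
      ; parts≥2    = ≤-trans (pred-mono-≤ x≥3) (m≤n+m _ _) ∷ predExceptFirstOdd-≥ xs≥3
      ; evensLast  = ¬P∷persists (λ e → even⇒¬odd (length xs + pred x) e headOdd)
                                 (persists-predExceptFirstOdd xs>0 xs-oddsLast)
      }
    ; sum-≡    = sum-≡
    ; decode-≡ =
        trans (decode-mixed ¬allOdd (¬oddLength ∘ subst Odd (length-predExceptFirstOdd xs)) ¬allEven)
              (cong₂ _∷_ head≡ (sucExceptLastOdd∘predExceptFirstOdd xs>0 xs-oddsLast xs-someOdd))
    }
    where
    headOdd : Odd (length xs + pred x)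
    headOdd = even+odd⇒odd (length xs) (¬odd⇒even (length xs) ¬oddLength)
                           (¬odd⇒odd-pred x x>0 ¬ox)

    ¬allEven : ¬ All Even (predExceptFirstOdd xs)
    ¬allEven = anyOdd⇒¬allEven (anyOdd-predExceptFirstOdd xs>0 xs-someOdd)

    head≡ : suc (length xs + pred x ∸ length (predExceptFirstOdd xs)) ≡ x
    head≡ = trans (cong (λ n → suc (length xs + pred x ∸ n)) (length-predExceptFirstOdd xs))
                  (trans (cong suc (m+n∸m≡n (length xs) (pred x))) (suc∘pred x>0))

    sum-≡ : length xs + pred x + sum (predExceptFirstOdd xs) ≡ x + sum xs
    sum-≡ = begin
      length xs + pred x + sum (predExceptFirstOdd xs)   ≡⟨ +-assoc (length xs) _ _ ⟩
      length xs + (pred x + sum (predExceptFirstOdd xs)) ≡⟨ x∙yz≈y∙xz (length xs) (pred x) _ ⟩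
      pred x + (length xs + sum (predExceptFirstOdd xs)) ≡⟨ cong (pred x +_) length+sum ⟩
      pred x + suc (sum xs)                              ≡⟨ +-suc (pred x) _ ⟩
      suc (pred x) + sum xs                              ≡⟨ cong (_+ sum xs) (suc∘pred x>0) ⟩
      x + sum xs                                         ∎
      where
      open ≡-Reasoning

      length+sum : length xs + sum (predExceptFirstOdd xs) ≡ suc (sum xs)
      length+sum = length+sum-predExceptFirstOdd xs-someOdd xs>0

encode-correct : ∀ {l} → OddsUnderEvens l → Encodes l (encode l)
encode-correct {[]} src = contradiction (OddsUnderEvens.someOdd src) λ ()
encode-correct {x ∷ []} src with odd? x
... | yes ox = encodes-allOdd src ox
... | no ¬ox = contradiction (Any.tail ¬ox (OddsUnderEvens.someOdd src)) λ ()
encode-correct {x ∷ xs@(_ ∷ _)} src with odd? x | odd? (length xs) | all? odd? (predExceptFirstOdd xs)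
... | yes ox | _          | _          = encodes-allOdd src ox
... | no ¬ox | yes odd    | _          = EvenLargestPart.encodes-oddLength src ¬ox odd
... | no ¬ox | no ¬odd    | yes allOdd = EvenLargestPart.encodes-oneOdd src ¬ox ¬odd allOdd
... | no ¬ox | no ¬odd    | no ¬allOdd = EvenLargestPart.encodes-manyOdds src ¬ox ¬odd ¬allOdd

-- Counting

module _ {A : Set} where

  ∈-++-∷⁻ : ∀ ys₁ {ys₂ : List A} {x u} → u ∈ ys₁ ++ x ∷ ys₂ → u ≢ x → u ∈ ys₁ ++ ys₂
  ∈-++-∷⁻ []        (here refl) u≢x = contradiction refl u≢x
  ∈-++-∷⁻ []        (there u∈)  _   = u∈
  ∈-++-∷⁻ (_ ∷ _)   (here refl) _   = here refl
  ∈-++-∷⁻ (_ ∷ ys₁) (there u∈)  u≢x = there (∈-++-∷⁻ ys₁ u∈ u≢x)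

  length-++-∷ : ∀ (ys₁ : List A) {x ys₂} → length (ys₁ ++ x ∷ ys₂) ≡ suc (length (ys₁ ++ ys₂))
  length-++-∷ ys₁ {x} {ys₂} = begin
    length (ys₁ ++ x ∷ ys₂)         ≡⟨ length-++ ys₁ ⟩
    length ys₁ + suc (length ys₂)   ≡⟨ +-suc (length ys₁) _ ⟩
    suc (length ys₁ + length ys₂)   ≡⟨ cong suc (sym (length-++ ys₁)) ⟩
    suc (length (ys₁ ++ ys₂))       ∎
    where open ≡-Reasoning

  unique∧⊆⇒length≤ : ∀ {xs ys : List A} → Unique xs → xs ⊆ ys → length xs ≤ length ys
  unique∧⊆⇒length≤ {[]}     _              _     = z≤n
  unique∧⊆⇒length≤ {x ∷ xs} (x∉xs ∷ uxs) xs⊆ys with ∈-∃++ (xs⊆ys (here refl))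
  ... | ys₁ , ys₂ , refl = subst (suc (length xs) ≤_) (sym (length-++-∷ ys₁))
    (s≤s (unique∧⊆⇒length≤ uxs λ u∈xs →
      ∈-++-∷⁻ ys₁ (xs⊆ys (there u∈xs)) λ u≡x → All.lookup x∉xs u∈xs (sym u≡x)))

  module _ {P Q : A → Set} (P? : Decidable P) (Q? : Decidable Q) where

    length-filter-< : ∀ {S} (f g : A → A) → Unique S → (∀ {x} → Q x → x ∈ S) →
                      (∀ {x} → P x → Q (f x)) → (∀ {x} → P x → g (f x) ≡ x) →
                      ∀ {w} → Q w → ¬ P (g w) → length (filter P? S) < length (filter Q? S)
    length-filter-< {S} f g uS Q⊆S f-Q g∘f {w} Qw ¬Pgw =
      subst (_< length (filter Q? S)) (length-map f xs)
        (unique∧⊆⇒length≤ (w∉image ∷ unique-image) w∷image⊆)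
      where
      xs : List A
      xs = filter P? S

      Pxs : All P xs
      Pxs = all-filter P? S

      unique-image : Unique (map f xs)
      unique-image = map⁻ (subst Unique (sym g∘f≡id) (Unique.filter⁺ P? uS))
        where
        g∘f≡id : map g (map f xs) ≡ xs
        g∘f≡id = trans (sym (map-∘ xs)) (map-id-local (All.map g∘f Pxs))

      w∉image : All (w ≢_) (map f xs)
      w∉image = All.tabulate w∉
        where
        w∉ : ∀ {v} → v ∈ map f xs → w ≢ v
        w∉ v∈ w≡v with ∈-map⁻ f v∈
        ... | x , x∈ , refl = ¬Pgw (subst P (sym (trans (cong g w≡v) (g∘f Px))) Px)
          where
          Px : P x
          Px = proj₂ (∈-filter⁻ P? {xs = S} x∈)

      w∷image⊆ : w ∷ map f xs ⊆ filter Q? S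
      w∷image⊆ (here refl) = ∈-filter⁺ Q? (Q⊆S Qw) Qw
      w∷image⊆ (there v∈) with ∈-map⁻ f v∈
      ... | x , x∈ , refl = ∈-filter⁺ Q? (Q⊆S Qfx) Qfx
        where
        Qfx : Q (f x)
        Qfx = f-Q (proj₂ (∈-filter⁻ P? {xs = S} x∈))

concatMap-map≡cartesianProductWith : ∀ {A B C : Set} (f : A → B → C) xs ys →
                                     concatMap (λ x → map (f x) ys) xs ≡ cartesianProductWith f xs ys
concatMap-map≡cartesianProductWith f []       ys = refl
concatMap-map≡cartesianProductWith f (x ∷ xs) ys =
  cong (map (f x) ys ++_) (concatMap-map≡cartesianProductWith f xs ys)

listsUpTo-suc : ∀ m k →
                listsUpTo m (suc k) ≡ [] ∷ cartesianProductWith _∷_ (map suc (upTo m)) (listsUpTo m k)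
listsUpTo-suc m k =
  cong ([] ∷_) (concatMap-map≡cartesianProductWith _∷_ (map suc (upTo m)) (listsUpTo m k))

unique-listsUpTo : ∀ m k → Unique (listsUpTo m k)
unique-listsUpTo m zero    = [] ∷ []
unique-listsUpTo m (suc k) = subst Unique (sym (listsUpTo-suc m k))
  (All.tabulate []∉ ∷ cartesianProductWith⁺ _∷_ ∷-injective
                        (Unique.map⁺ suc-injective (upTo⁺ m)) (unique-listsUpTo m k))
  where
  []∉ : ∀ {v} → v ∈ cartesianProductWith _∷_ (map suc (upTo m)) (listsUpTo m k) → [] ≢ v
  []∉ v∈ with ∈-cartesianProductWith⁻ _∷_ (map suc (upTo m)) (listsUpTo m k) v∈
  ... | _ , _ , _ , _ , refl = λ ()

∈-listsUpTo : ∀ m k {ν} → All (λ p → 0 < p × p ≤ m) ν → length ν ≤ k → ν ∈ listsUpTo m k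
∈-listsUpTo m zero    []                 _         = here refl
∈-listsUpTo m (suc k) []                 _         = here refl
∈-listsUpTo m (suc k) {p ∷ ν} (p∈ ∷ ps) (s≤s len≤k) =
  subst (p ∷ ν ∈_) (sym (listsUpTo-suc m k))
    (there (∈-cartesianProductWith⁺ _∷_ (head∈ p∈) (∈-listsUpTo m k ps len≤k)))
  where
  head∈ : ∀ {p} → 0 < p × p ≤ m → p ∈ map suc (upTo m)
  head∈ (s≤s _ , p≤m) = ∈-map⁺ suc (∈-upTo⁺ p≤m)

parts≤sum : ∀ ν → All (_≤ sum ν) ν
parts≤sum []      = []
parts≤sum (p ∷ ν) = m≤m+n p _ ∷ All.map (λ q≤ → ≤-trans q≤ (m≤n+m _ p)) (parts≤sum ν)

length≤sum : ∀ {ν} → All (0 <_) ν → length ν ≤ sum ν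
length≤sum []       = z≤n
length≤sum (p ∷ ps) = +-mono-≤ p (length≤sum ps)

partition∈listsUpTo : ∀ {n ν} → IsPartition n ν → ν ∈ listsUpTo n n
partition∈listsUpTo {ν = ν} (_ , parts>0 , refl) =
  ∈-listsUpTo (sum ν) (sum ν) (All.zip (parts>0 , parts≤sum ν)) (length≤sum parts>0)

encode-Qeuou : ∀ {n l} → Qoueu n l → Qeuou n (encode l)
encode-Qeuou {l = l} q@((_ , _ , sum≡n) , _) =
  evensUnderOdds⇒Qeuou (Encodes.shape codes) (trans (Encodes.sum-≡ codes) sum≡n)
  where
  codes : Encodes l (encode l)
  codes = encode-correct (Qoueu⇒oddsUnderEvens q)

decode∘encode : ∀ {n l} → Qoueu n l → decode (encode l) ≡ l
decode∘encode = Encodes.decode-≡ ∘ encode-correct ∘ Qoueu⇒oddsUnderEvens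

-- Each witness decodes to a list with a part below 3, so it is not an encoding.
Qeuou-not-encoded : ∀ n → 3 < n → ∃[ w ] Qeuou n w × ¬ OddsUnderEvens (decode w)
Qeuou-not-encoded 1 (s≤s ())
Qeuou-not-encoded 2 (s≤s (s≤s ()))
Qeuou-not-encoded 3 (s≤s (s≤s (s≤s ())))
Qeuou-not-encoded 4 _ = 2 ∷ 2 ∷ [] ,
  evensUnderOdds⇒Qeuou (record
    { descending = ≤-refl ∷ [-]
    ; parts≥2    = ≤-refl ∷ ≤-refl ∷ []
    ; evensLast  = (λ _ → refl) ∷ [-]
    }) refl ,
  λ src → <⇒≱ (s≤s (s≤s z≤n)) (All.head (OddsUnderEvens.parts≥3 src))
Qeuou-not-encoded 5 _ = 3 ∷ 2 ∷ [] ,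
  evensUnderOdds⇒Qeuou (record
    { descending = n≤1+n 2 ∷ [-]
    ; parts≥2    = n≤1+n 2 ∷ ≤-refl ∷ []
    ; evensLast  = (λ _ → refl) ∷ [-]
    }) refl ,
  λ src → <-irrefl refl (All.head (OddsUnderEvens.parts≥3 src))
Qeuou-not-encoded (suc (suc (suc (suc (suc (suc k)))))) _ = suc (suc k) ∷ 2 ∷ 2 ∷ [] ,
  evensUnderOdds⇒Qeuou (record
    { descending = s≤s (s≤s z≤n) ∷ ≤-refl ∷ [-]
    ; parts≥2    = s≤s (s≤s z≤n) ∷ ≤-refl ∷ ≤-refl ∷ []
    ; evensLast  = (λ _ → refl) ∷ (λ _ → refl) ∷ [-]
    }) (cong (suc ∘ suc) (+-comm k 4)) ,
  λ src → <-irrefl refl (All.head (All.tail (OddsUnderEvens.parts≥3 src)))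

theorem4p2 : (n : ℕ) → 3 < n → q-ou-eu n < q-eu-ou n
theorem4p2 n 3<n with Qeuou-not-encoded n 3<n
... | w , Qw , ¬src =
  length-filter-< (Qoueu? n) (Qeuou? n) encode decode
    (unique-listsUpTo n n) (partition∈listsUpTo ∘ proj₁) encode-Qeuou decode∘encode
    Qw (¬src ∘ Qoueu⇒oddsUnderEvens)
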